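{- A bipartite distance-regular graph with diameter $4$ does not admit a perfect $1$-code.
   Context: A connected graph of diameter $d$ is distance-regular if for any two vertices $x,y$ at distance $i$ the number of neighbours of $x$ at distance $i+1$ (resp. $i-1$) from $y$ depends only on $i$. A perfect $1$-code is a vertex subset $C$ such that the closed neighbourhoods of the vertices of $C$ partition the vertex set. -}

module Defs where

open import Data.Nat using (ℕ; zero; suc; _∸_; _≤_)
open import Data.Bool using (Bool; true; false; _∧_; _∨_; not)
open import Data.Fin using (Fin)
open import Data.Fin.Properties using () renaming (_≟_ to _≟ᶠ_)
open import Data.List using (List; length; filterᵇ)
open import Data.Bool.ListAction using (any)
open import Data.List.Base using (allFin)
open import Data.Product using (Σ; ∃; _×_; _,_)
open import Relation.Nullary using (¬_)
open import Relation.Nullary.Decidable using (isYes)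
open import Relation.Binary.PropositionalEquality using (_≡_; _≢_)

record Graph (n : ℕ) : Set where
  field
    adj    : Fin n → Fin n → Bool
    sym    : ∀ x y → adj x y ≡ adj y x
    irrefl : ∀ x → adj x x ≡ false

module _ {n : ℕ} (G : Graph n) where
  open Graph G

  eqᵇ : Fin n → Fin n → Bool
  eqᵇ x y = isYes (x ≟ᶠ y)

  reach : ℕ → Fin n → Fin n → Bool
  reach zero    x y = eqᵇ x y
  reach (suc k) x y = reach k x y ∨ any (λ z → adj x z ∧ reach k z y) (allFin n)

  isDist : Fin n → Fin n → ℕ → Bool
  isDist x y zero    = eqᵇ x y
  isDist x y (suc i) = reach (suc i) x y ∧ not (reach i x y)

  Dist : Fin n → Fin n → ℕ → Set
  Dist x y i = isDist x y i ≡ true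

  count : (Fin n → Bool) → ℕ
  count P = length (filterᵇ P (allFin n))

  nbrsAt : Fin n → Fin n → ℕ → ℕ
  nbrsAt x y j = count (λ z → adj x z ∧ isDist z y j)

  Connected : Set
  Connected = ∀ x y → ∃ λ i → Dist x y i

  HasDiameter : ℕ → Set
  HasDiameter d = Connected × (∀ x y i → Dist x y i → i ≤ d)
                  × (∃ λ x → ∃ λ y → Dist x y d)

  DistanceRegular : Set
  DistanceRegular =
    Connected ×
    (∀ i x y x' y' → Dist x y (suc i) → Dist x' y' (suc i) →
        nbrsAt x y i ≡ nbrsAt x' y' i) ×
    (∀ i x y x' y' → Dist x y i → Dist x' y' i →
        nbrsAt x y (suc i) ≡ nbrsAt x' y' (suc i))

  Bipartite : Set
  Bipartite = Σ (Fin n → Bool) λ col → ∀ x y → adj x y ≡ true → col x ≢ col y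

  inClosedNbhd : Fin n → Fin n → Bool
  inClosedNbhd c v = eqᵇ c v ∨ adj c v

  PerfectCode : (Fin n → Bool) → Set
  PerfectCode C = ∀ v →
    (∃ λ c → C c ≡ true × inClosedNbhd c v ≡ true) ×
    (∀ c c' → C c ≡ true → inClosedNbhd c v ≡ true →
              C c' ≡ true → inClosedNbhd c' v ≡ true → c ≡ c')

{-# OPTIONS --safe #-}
module Submission where

-- Fix a codeword c and let Lᵢ be the set of vertices at distance i from c, with aᵢ codewords
-- in Lᵢ. Codewords are at distance ≥ 3 from each other, so by bipartiteness every vertex of L₂
-- is covered by a codeword of L₃, every other vertex of L₃ by one of L₄, and every other vertex
-- of L₄ by one of L₃. Double counting these coverings and the edges between consecutive layers
-- gives |L₂| = a₃c₃, |L₃| = a₃ + a₄k, |L₄| = a₄ + a₃b₃, |L₂|b₂ = |L₃|c₃ and |L₃|b₃ = |L₄|k.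
-- Together with k = b₂ + c₂ these force 1 = b₂ + c₂b₃, although b₂, c₂, b₃ ≥ 1.

open import Defs
open import Data.Nat using (ℕ; zero; suc; _+_; _*_; _≤_; _<_; z≤n; s≤s; >-nonZero)
open import Data.Nat.Properties
open import Data.Nat.GeneralisedArithmetic using (fold)
open import Data.Nat.Tactic.RingSolver using (solve)
open import Data.Bool as Bool using (Bool; true; false; _∧_; _∨_; not)
open import Data.Bool.Properties using (∨-zeroʳ; ∧-zeroʳ; ∧-conicalˡ; ∧-conicalʳ; ∧-identityʳ; ¬-not; T-≡; not-injective)
open import Data.Fin as Fin using (Fin; punchIn)
open import Data.Fin.Properties using (any?; punchInᵢ≢i)
open import Data.List using (_∷_; []; length; filterᵇ; tabulate; allFin)
open import Data.List.Membership.Propositional using (lose)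
open import Data.List.Membership.Propositional.Properties using (∈-allFin)
open import Data.List.Relation.Unary.Any using (satisfied)
open import Data.List.Relation.Unary.Any.Properties using (any⁺; any⁻)
open import Data.Bool.ListAction using (any)
open import Data.Product using (Σ; ∃; _×_; _,_; proj₁; proj₂)
open import Data.Sum using (_⊎_; inj₁; inj₂)
open import Data.Empty using (⊥; ⊥-elim)
open import Function using (_∘_)
open import Function.Bundles using (Equivalence)
open import Relation.Nullary using (¬_; yes; no; contradiction)
open import Relation.Nullary.Decidable using (isYes≗does; dec-true; dec-false)
open import Relation.Binary.Definitions using (tri<; tri≈; tri>)
open import Relation.Binary.PropositionalEquality
open import Algebra.Properties.Semiring.Sum +-*-semiring

open Equivalence using (to; from)

𝟙 : Bool → ℕ
𝟙 true  = 1
𝟙 false = 0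

private variable
  n : ℕ

size : (Fin n → Bool) → ℕ
size {n} P = ∑[ x < n ] 𝟙 (P x)

size-cong : {P Q : Fin n → Bool} → (∀ x → P x ≡ Q x) → size P ≡ size Q
size-cong P≗Q = sum-cong-≗ (cong 𝟙 ∘ P≗Q)

size-false : {P : Fin n → Bool} → (∀ x → P x ≡ false) → size P ≡ 0
size-false {n} {P} P≗false = trans (size-cong P≗false) (sum-replicate-zero n)

size-partition : (P A : Fin n → Bool) →
  size P ≡ size (λ x → P x ∧ A x) + size (λ x → P x ∧ not (A x))
size-partition P A =
  trans (sum-cong-≗ λ x → 𝟙-split (P x) (A x)) (∑-distrib-+ (λ x → 𝟙 (P x ∧ A x)) (λ x → 𝟙 (P x ∧ not (A x))))
  where
  𝟙-split : ∀ p a → 𝟙 p ≡ 𝟙 (p ∧ a) + 𝟙 (p ∧ not a)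
  𝟙-split true  true  = refl
  𝟙-split true  false = refl
  𝟙-split false _     = refl

𝟙*size : ∀ b (P : Fin n → Bool) → 𝟙 b * size P ≡ size (λ x → b ∧ P x)
𝟙*size true  P = +-identityʳ (size P)
𝟙*size {n} false P = sym (sum-replicate-zero n)

weighted-size : (P : Fin n → Bool) (f : Fin n → ℕ) (r : ℕ) →
  (∀ x → P x ≡ true → f x ≡ r) → ∑[ x < n ] (𝟙 (P x) * f x) ≡ size P * r
weighted-size {n} P f r f≡r = trans (sum-cong-≗ weight) (sym (*-distribʳ-sum r (𝟙 ∘ P)))
  where
  weight : ∀ x → 𝟙 (P x) * f x ≡ 𝟙 (P x) * r
  weight x with P x in Px
  ... | true  = cong (_+ 0) (f≡r x Px)
  ... | false = refl

size-pos : (P : Fin n → Bool) (a : Fin n) → P a ≡ true → 1 ≤ size P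
size-pos {suc _} P a Pa = begin
  1                                ≡⟨ cong 𝟙 Pa ⟨
  𝟙 (P a)                          ≤⟨ m≤m+n _ _ ⟩
  𝟙 (P a) + size (P ∘ punchIn a)   ≡⟨ sum-remove {i = a} (𝟙 ∘ P) ⟨
  size P                           ∎
  where open ≤-Reasoning

size≡1 : (P : Fin n → Bool) (a : Fin n) → P a ≡ true → (∀ x → P x ≡ true → x ≡ a) → size P ≡ 1
size≡1 {suc _} P a Pa unique = begin
  size P                                  ≡⟨ sum-remove {i = a} (𝟙 ∘ P) ⟩
  𝟙 (P a) + size (P ∘ punchIn a)          ≡⟨ cong₂ _+_ (cong 𝟙 Pa) (size-false others) ⟩
  1                                       ∎
  where
  open ≡-Reasoning
  others : ∀ x → P (punchIn a x) ≡ false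
  others x with P (punchIn a x) in Px
  ... | true  = ⊥-elim (punchInᵢ≢i a x (unique _ Px))
  ... | false = refl

size-pos⇒∃ : (P : Fin n → Bool) → 1 ≤ size P → ∃ λ x → P x ≡ true
size-pos⇒∃ P 1≤size with any? (λ x → P x Bool.≟ true)
... | yes witness = witness
... | no ∄ = contradiction (size-false none) (≢-sym (<⇒≢ 1≤size))
  where
  none : ∀ x → P x ≡ false
  none x = ¬-not (λ Px → ∄ (x , Px))

size-double-count : (P Q : Fin n → Bool) (R : Fin n → Fin n → Bool) (r s : ℕ) →
  (∀ x → P x ≡ true → size (λ y → R x y ∧ Q y) ≡ r) →
  (∀ y → Q y ≡ true → size (λ x → R x y ∧ P x) ≡ s) →
  size P * r ≡ size Q * s
size-double-count {n} P Q R r s P→r Q→s = begin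
  size P * r                                           ≡⟨ weighted-size P _ r P→r ⟨
  ∑[ x < n ] (𝟙 (P x) * size (λ y → R x y ∧ Q y))      ≡⟨ sum-cong-≗ (λ x → 𝟙*size (P x) (λ y → R x y ∧ Q y)) ⟩
  ∑[ x < n ] ∑[ y < n ] 𝟙 (P x ∧ (R x y ∧ Q y))        ≡⟨ ∑-comm (λ x y → 𝟙 (P x ∧ (R x y ∧ Q y))) ⟩
  ∑[ y < n ] ∑[ x < n ] 𝟙 (P x ∧ (R x y ∧ Q y))        ≡⟨ sum-cong-≗ (λ y → sum-cong-≗ λ x → cong 𝟙 (incidence (P x) (R x y) (Q y))) ⟩
  ∑[ y < n ] ∑[ x < n ] 𝟙 (Q y ∧ (R x y ∧ P x))        ≡⟨ sum-cong-≗ (λ y → 𝟙*size (Q y) (λ x → R x y ∧ P x)) ⟨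
  ∑[ y < n ] (𝟙 (Q y) * size (λ x → R x y ∧ P x))      ≡⟨ weighted-size Q _ s Q→s ⟩
  size Q * s                                           ∎
  where
  open ≡-Reasoning
  incidence : ∀ p r q → p ∧ (r ∧ q) ≡ q ∧ (r ∧ p)
  incidence true  r true  = refl
  incidence true  r false = ∧-zeroʳ r
  incidence false r true  = sym (∧-zeroʳ r)
  incidence false r false = refl

length-filterᵇ-tabulate : ∀ {a} {A : Set a} {n} (P : A → Bool) (f : Fin n → A) →
  length (filterᵇ P (tabulate f)) ≡ ∑[ i < n ] 𝟙 (P (f i))
length-filterᵇ-tabulate {n = zero}  P f = refl
length-filterᵇ-tabulate {n = suc n} P f with P (f Fin.zero)
... | true  = cong suc (length-filterᵇ-tabulate P (f ∘ Fin.suc))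
... | false = length-filterᵇ-tabulate P (f ∘ Fin.suc)

any-allFin⁺ : (p : Fin n → Bool) (x : Fin n) → p x ≡ true → any p (allFin n) ≡ true
any-allFin⁺ p x px = to T-≡ (any⁺ p (lose (∈-allFin x) (from T-≡ px)))

any-allFin⁻ : (p : Fin n → Bool) → any p (allFin n) ≡ true → ∃ λ x → p x ≡ true
any-allFin⁻ p h with x , px ← satisfied (any⁻ p (allFin _) (from T-≡ h)) = x , to T-≡ px

module Distances {n : ℕ} (G : Graph n) where
  open Graph G renaming (sym to adj-sym)

  eqᵇ⇒≡ : ∀ {x y} → eqᵇ G x y ≡ true → x ≡ y
  eqᵇ⇒≡ {x} {y} eq with x Fin.≟ y
  ... | yes x≡y = x≡y

  eqᵇ-refl : ∀ x → eqᵇ G x x ≡ true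
  eqᵇ-refl x = trans (isYes≗does (x Fin.≟ x)) (dec-true (x Fin.≟ x) refl)

  eqᵇ-false : ∀ {x y} → x ≢ y → eqᵇ G x y ≡ false
  eqᵇ-false {x} {y} x≢y = trans (isYes≗does (x Fin.≟ y)) (dec-false (x Fin.≟ y) x≢y)

  adj⇒≢ : ∀ {x y} → adj x y ≡ true → x ≢ y
  adj⇒≢ {x} xy refl = contradiction (trans (sym xy) (irrefl x)) λ ()

  dist-suc⇒¬reach : ∀ {x y} i → Dist G x y (suc i) → reach G i x y ≢ true
  dist-suc⇒¬reach i d r = contradiction (trans (sym (cong not r)) (∧-conicalʳ _ _ d)) λ ()

  reach-suc : ∀ {k x y} → reach G k x y ≡ true → reach G (suc k) x y ≡ true
  reach-suc r rewrite r = refl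

  reach-mono : ∀ {k m x y} → k ≤ m → reach G k x y ≡ true → reach G m x y ≡ true
  reach-mono {m = zero}  z≤n r = r
  reach-mono {m = suc m} k≤m r with m≤n⇒m<n∨m≡n k≤m
  ... | inj₁ k<m  = reach-suc {m} (reach-mono (≤-pred k<m) r)
  ... | inj₂ refl = r

  reach-step : ∀ k {x z y} → adj x z ≡ true → reach G k z y ≡ true → reach G (suc k) x y ≡ true
  reach-step k {x} {z} {y} xz r with reach G k x y
  ... | true  = refl
  ... | false = any-allFin⁺ (λ w → adj x w ∧ reach G k w y) z (cong₂ _∧_ xz r)

  reach-suc⁻ : ∀ k {x y} → reach G (suc k) x y ≡ true →
    reach G k x y ≡ true ⊎ ∃ λ z → adj x z ≡ true × reach G k z y ≡ true
  reach-suc⁻ k {x} {y} r with reach G k x y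
  ... | true  = inj₁ refl
  ... | false with z , h ← any-allFin⁻ (λ w → adj x w ∧ reach G k w y) r =
    inj₂ (z , ∧-conicalˡ _ _ h , ∧-conicalʳ _ _ h)

  dist⇒reach : ∀ {x y} i → Dist G x y i → reach G i x y ≡ true
  dist⇒reach zero    d = d
  dist⇒reach (suc i) d = ∧-conicalˡ _ _ d

  dist-min : ∀ {x y} i m → Dist G x y i → reach G m x y ≡ true → i ≤ m
  dist-min zero    m d r = z≤n
  dist-min (suc i) m d r with suc i ≤? m
  ... | yes i<m = i<m
  ... | no  i≮m = contradiction (reach-mono (≤-pred (≰⇒> i≮m)) r) (dist-suc⇒¬reach i d)

  dist-unique : ∀ {x y} i j → Dist G x y i → Dist G x y j → i ≡ j
  dist-unique i j dᵢ dⱼ =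
    ≤-antisym (dist-min i j dᵢ (dist⇒reach j dⱼ)) (dist-min j i dⱼ (dist⇒reach i dᵢ))

  reach⇒dist : ∀ m {x y} → reach G m x y ≡ true → ∃ λ i → i ≤ m × Dist G x y i
  reach⇒dist zero    r = zero , z≤n , r
  reach⇒dist (suc m) {x} {y} r with reach G m x y Bool.≟ true
  ... | yes r′ with i , i≤m , d ← reach⇒dist m r′ = i , m≤n⇒m≤1+n i≤m , d
  ... | no ¬r′ = suc m , ≤-refl , cong₂ _∧_ r (cong not (¬-not ¬r′))

  dist-pred : ∀ {x y} i → Dist G x y (suc i) → ∃ λ z → adj x z ≡ true × Dist G z y i
  dist-pred i d with reach-suc⁻ i (dist⇒reach (suc i) d)
  ... | inj₁ r = contradiction r (dist-suc⇒¬reach i d)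
  ... | inj₂ (z , xz , r) with j , j≤i , dⱼ ← reach⇒dist i r
    with i≤j ← ≤-pred (dist-min (suc i) (suc j) d (reach-step j xz (dist⇒reach j dⱼ)))
    rewrite ≤-antisym j≤i i≤j = z , xz , dⱼ

  adj-dist-≤ : ∀ {x z y} i j → adj x z ≡ true → Dist G x y i → Dist G z y j → i ≤ suc j
  adj-dist-≤ i j xz dᵢ dⱼ = dist-min i (suc j) dᵢ (reach-step j xz (dist⇒reach j dⱼ))

  adj⇒dist1 : ∀ {x y} → adj x y ≡ true → Dist G x y 1
  adj⇒dist1 {x} {y} xy rewrite eqᵇ-false (adj⇒≢ xy) =
    trans (∧-identityʳ _) (any-allFin⁺ (λ z → adj x z ∧ eqᵇ G z y) y (cong₂ _∧_ xy (eqᵇ-refl y)))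

  dist1⇒adj : ∀ {x y} → Dist G x y 1 → adj x y ≡ true
  dist1⇒adj {x} d with z , xz , z≡y ← dist-pred 0 d = subst (λ w → adj x w ≡ true) (eqᵇ⇒≡ z≡y) xz

  colour-parity : ((col , _) : Bipartite G) → ∀ {x y} i → Dist G x y i → col x ≡ fold (col y) not i
  colour-parity (col , _)   zero    d = cong col (eqᵇ⇒≡ d)
  colour-parity (col , bip) (suc i) d with z , xz , dᵢ ← dist-pred i d =
    trans (¬-not (bip _ z xz)) (cong not (colour-parity (col , bip) i dᵢ))

  bipartite-adj-dist : Bipartite G → ∀ {x z y} i j → adj x z ≡ true →
    Dist G x y i → Dist G z y j → j ≡ suc i ⊎ i ≡ suc j
  bipartite-adj-dist (col , bip) {x} {z} i j xz dᵢ dⱼ with <-cmp i j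
  ... | tri< i<j _ _ = inj₁ (≤-antisym (adj-dist-≤ j i (trans (adj-sym z x) xz) dⱼ dᵢ) i<j)
  ... | tri≈ _ refl _ = contradiction
    (trans (colour-parity (col , bip) i dᵢ) (sym (colour-parity (col , bip) i dⱼ))) (bip x z xz)
  ... | tri> _ _ j<i = inj₂ (≤-antisym (adj-dist-≤ i j xz dᵢ dⱼ) j<i)

module Neighbourhoods {n : ℕ} (G : Graph n) where
  open Graph G renaming (sym to adj-sym)
  open Distances G

  nbrs : Fin n → (Fin n → Bool) → ℕ
  nbrs x P = size (λ z → adj x z ∧ P z)

  degree : Fin n → ℕ
  degree x = nbrs x (λ _ → true)

  nbrsAt≡nbrs : ∀ x y j → nbrsAt G x y j ≡ nbrs x (λ z → isDist G z y j)
  nbrsAt≡nbrs x y j = length-filterᵇ-tabulate (λ z → adj x z ∧ isDist G z y j) (λ z → z)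

  nbrs-cong : ∀ {x P Q} → (∀ z → adj x z ≡ true → P z ≡ Q z) → nbrs x P ≡ nbrs x Q
  nbrs-cong {x} P≗Q = size-cong on-nbrs
    where
    on-nbrs : ∀ z → (adj x z ∧ _) ≡ (adj x z ∧ _)
    on-nbrs z with adj x z in xz
    ... | true  = P≗Q z xz
    ... | false = refl

  nbrs-pos : ∀ {x z} (P : Fin n → Bool) → adj x z ≡ true → P z ≡ true → 1 ≤ nbrs x P
  nbrs-pos {x} {z} P xz Pz = size-pos (λ w → adj x w ∧ P w) z (cong₂ _∧_ xz Pz)

  nbrs-pos⇒∃ : ∀ {x} (P : Fin n → Bool) → 1 ≤ nbrs x P → ∃ λ z → adj x z ≡ true × P z ≡ true
  nbrs-pos⇒∃ {x} P pos with z , h ← size-pos⇒∃ (λ w → adj x w ∧ P w) pos =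
    z , ∧-conicalˡ _ _ h , ∧-conicalʳ _ _ h

  degree-partition : ∀ x (A : Fin n → Bool) → degree x ≡ nbrs x A + nbrs x (not ∘ A)
  degree-partition x A = trans (size-cong (∧-identityʳ ∘ adj x)) (size-partition (adj x) A)

  nbrs-∧-redundant : ∀ {x} (A B : Fin n → Bool) →
    (∀ z → adj x z ≡ true → B z ≡ true → A z ≡ true) → nbrs x (λ z → A z ∧ B z) ≡ nbrs x B
  nbrs-∧-redundant A B B⇒A = nbrs-cong on-nbrs
    where
    on-nbrs : ∀ z → _ → A z ∧ B z ≡ B z
    on-nbrs z xz with B z in Bz
    ... | true  = trans (∧-identityʳ (A z)) (B⇒A z xz Bz)
    ... | false = ∧-zeroʳ (A z)

  nbrs-double-count : (P Q : Fin n → Bool) (r s : ℕ) →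
    (∀ x → P x ≡ true → nbrs x Q ≡ r) → (∀ y → Q y ≡ true → nbrs y P ≡ s) →
    size P * r ≡ size Q * s
  nbrs-double-count P Q r s P→r Q→s = size-double-count P Q adj r s P→r
    λ y Qy → trans (size-cong λ x → cong (_∧ P x) (adj-sym x y)) (Q→s y Qy)

module DistanceRegularGraphs {n : ℕ} (G : Graph n) where
  open Graph G renaming (sym to adj-sym)
  open Distances G
  open Neighbourhoods G

  degree-regular : DistanceRegular G → ∀ x y → degree x ≡ degree y
  degree-regular (_ , _ , b-const) x y = begin
    degree x          ≡⟨ degree≡nbrsAt x ⟩
    nbrsAt G x x 1    ≡⟨ b-const 0 x x y y (eqᵇ-refl x) (eqᵇ-refl y) ⟩
    nbrsAt G y y 1    ≡⟨ degree≡nbrsAt y ⟨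
    degree y          ∎
    where
    open ≡-Reasoning
    degree≡nbrsAt : ∀ x → degree x ≡ nbrsAt G x x 1
    degree≡nbrsAt x = trans (nbrs-cong λ z xz → sym (adj⇒dist1 (trans (adj-sym z x) xz)))
                            (sym (nbrsAt≡nbrs x x 1))

  nbrs-outward-const : DistanceRegular G → ∀ {x x′ y} i → Dist G x y i → Dist G x′ y i →
    nbrs x (λ z → isDist G z y (suc i)) ≡ nbrs x′ (λ z → isDist G z y (suc i))
  nbrs-outward-const (_ , _ , b-const) {x} {x′} {y} i dx dx′ =
    trans (sym (nbrsAt≡nbrs x y (suc i))) (trans (b-const i x y x′ y dx dx′) (nbrsAt≡nbrs x′ y (suc i)))

  nbrs-inward-const : DistanceRegular G → ∀ {x x′ y} i → Dist G x y (suc i) → Dist G x′ y (suc i) →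
    nbrs x (λ z → isDist G z y i) ≡ nbrs x′ (λ z → isDist G z y i)
  nbrs-inward-const (_ , c-const , _) {x} {x′} {y} i dx dx′ =
    trans (sym (nbrsAt≡nbrs x y i)) (trans (c-const i x y x′ y dx dx′) (nbrsAt≡nbrs x′ y i))

  geodesic-edge : ∀ {p q} d i → Dist G p q d → i < d →
    ∃ λ w → ∃ λ z → Dist G w q i × adj w z ≡ true × Dist G z q (suc i)
  geodesic-edge {p} (suc d) i pq i<d with p′ , pp′ , p′q ← dist-pred d pq
    with m≤n⇒m<n∨m≡n i<d
  ... | inj₁ i<d′ = geodesic-edge d i p′q (≤-pred i<d′)
  ... | inj₂ refl = p′ , p , p′q , trans (adj-sym p′ p) pp′ , pq

  outward-nbr : DistanceRegular G → ∀ {p q d} → Dist G p q d →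
    ∀ {x y} i → i < d → Dist G x y i → ∃ λ z → adj x z ≡ true × Dist G z y (suc i)
  outward-nbr (_ , _ , b-const) {d = d} pq {x} {y} i i<d dᵢ
    with w , z , dw , wz , dz ← geodesic-edge d i pq i<d =
    nbrs-pos⇒∃ _ (begin
      1                                  ≤⟨ nbrs-pos _ wz dz ⟩
      nbrs w (λ v → isDist G v _ (suc i)) ≡⟨ nbrsAt≡nbrs w _ (suc i) ⟨
      nbrsAt G w _ (suc i)               ≡⟨ b-const i w _ x y dw dᵢ ⟩
      nbrsAt G x y (suc i)               ≡⟨ nbrsAt≡nbrs x y (suc i) ⟩
      nbrs x (λ v → isDist G v y (suc i)) ∎)
    where open ≤-Reasoning

module PerfectCodes {n : ℕ} (G : Graph n) {C : Fin n → Bool} (code : PerfectCode G C) where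
  open Graph G renaming (sym to adj-sym)
  open Distances G
  open Neighbourhoods G

  adj⇒inClosedNbhd : ∀ {w v} → adj w v ≡ true → inClosedNbhd G w v ≡ true
  adj⇒inClosedNbhd {w} {v} wv = trans (cong (eqᵇ G w v ∨_) wv) (∨-zeroʳ _)

  inClosedNbhd-self : ∀ w → inClosedNbhd G w w ≡ true
  inClosedNbhd-self w = cong (_∨ adj w w) (eqᵇ-refl w)

  inClosedNbhd⇒ : ∀ {w v} → inClosedNbhd G w v ≡ true → w ≡ v ⊎ adj w v ≡ true
  inClosedNbhd⇒ {w} {v} h with eqᵇ G w v in w≡v
  ... | true  = inj₁ (eqᵇ⇒≡ w≡v)
  ... | false = inj₂ h

  covering-unique : ∀ {v w w′} → C w ≡ true → inClosedNbhd G w v ≡ true →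
    C w′ ≡ true → inClosedNbhd G w′ v ≡ true → w ≡ w′
  covering-unique {v} = proj₂ (code v) _ _

  codewords-nonadjacent : ∀ {w w′} → C w ≡ true → C w′ ≡ true → adj w w′ ≢ true
  codewords-nonadjacent {w′ = w′} Cw Cw′ ww′ =
    adj⇒≢ ww′ (covering-unique Cw (adj⇒inClosedNbhd ww′) Cw′ (inClosedNbhd-self w′))

  nbr-of-codeword : ∀ {w z} → C w ≡ true → adj w z ≡ true → C z ≡ false
  nbr-of-codeword Cw wz = ¬-not λ Cz → codewords-nonadjacent Cw Cz wz

  nbrs-noncode : ∀ {w} → C w ≡ true → (A : Fin n → Bool) → nbrs w (λ z → A z ∧ not (C z)) ≡ nbrs w A
  nbrs-noncode Cw A = nbrs-cong λ z wz →
    trans (cong (λ b → A z ∧ not b) (nbr-of-codeword Cw wz)) (∧-identityʳ (A z))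

  codewords-not-at-distance-2 : ∀ {w w′} → C w ≡ true → C w′ ≡ true → ¬ Dist G w w′ 2
  codewords-not-at-distance-2 {w} {w′} Cw Cw′ d₂
    with u , wu , d₁ ← dist-pred 1 d₂
    with refl ← covering-unique Cw (adj⇒inClosedNbhd wu) Cw′
                  (adj⇒inClosedNbhd (trans (adj-sym w′ u) (dist1⇒adj d₁)))
    with () ← dist-unique 2 0 d₂ (eqᵇ-refl w)

  nbrs-code≡1 : ∀ {x} → C x ≡ false → nbrs x C ≡ 1
  nbrs-code≡1 {x} Cx with w , Cw , w∋x ← proj₁ (code x) with inClosedNbhd⇒ w∋x
  ... | inj₁ refl = contradiction (trans (sym Cw) Cx) λ ()
  ... | inj₂ wx   = size≡1 (λ z → adj x z ∧ C z) w (cong₂ _∧_ (trans (adj-sym x w) wx) Cw)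
    λ w′ h → covering-unique (∧-conicalʳ _ _ h)
      (adj⇒inClosedNbhd (trans (adj-sym w′ x) (∧-conicalˡ _ _ h))) Cw w∋x

layer-equations-inconsistent : ∀ {k b₂ c₂ b₃ c₃ a₃ a₄ l₂ l₃ l₄} →
  k ≡ b₂ + c₂ → l₂ ≡ a₃ * c₃ → l₃ ≡ a₃ + a₄ * k → l₄ ≡ a₄ + a₃ * b₃ →
  l₂ * b₂ ≡ l₃ * c₃ → l₃ * b₃ ≡ l₄ * k →
  1 ≤ l₂ → 1 ≤ b₂ → 1 ≤ c₂ → 1 ≤ b₃ → ⊥
layer-equations-inconsistent {k} {b₂} {c₂} {b₃} {c₃} {a₃} {a₄} {l₂} {l₃} {l₄}
  k≡ l₂≡ l₃≡ l₄≡ e₂ e₃ 1≤l₂ 1≤b₂ 1≤c₂ 1≤b₃ =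
  <-irrefl one≡ (+-mono-≤ 1≤b₂ (*-mono-≤ 1≤c₂ 1≤b₃))
  where
  open ≡-Reasoning
  cancelled : l₂ * (b₂ * b₃ + 1) ≡ l₂ * (b₂ + k * b₃)
  cancelled = begin
    l₂ * (b₂ * b₃ + 1)                      ≡⟨ solve (l₂ ∷ b₂ ∷ b₃ ∷ []) ⟩
    l₂ * b₂ * b₃ + l₂                       ≡⟨ cong (λ t → t * b₃ + l₂) e₂ ⟩
    l₃ * c₃ * b₃ + l₂                       ≡⟨ solve (l₃ ∷ c₃ ∷ b₃ ∷ l₂ ∷ []) ⟩
    c₃ * (l₃ * b₃) + l₂                     ≡⟨ cong (λ t → c₃ * t + l₂) e₃ ⟩
    c₃ * (l₄ * k) + l₂                      ≡⟨ cong₂ (λ s t → c₃ * (s * k) + t) l₄≡ l₂≡ ⟩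
    c₃ * ((a₄ + a₃ * b₃) * k) + a₃ * c₃     ≡⟨ solve (c₃ ∷ a₄ ∷ a₃ ∷ b₃ ∷ k ∷ []) ⟩
    (a₃ + a₄ * k) * c₃ + a₃ * c₃ * (k * b₃) ≡⟨ cong₂ (λ s t → s * c₃ + t * (k * b₃)) l₃≡ l₂≡ ⟨
    l₃ * c₃ + l₂ * (k * b₃)                 ≡⟨ cong (_+ l₂ * (k * b₃)) e₂ ⟨
    l₂ * b₂ + l₂ * (k * b₃)                 ≡⟨ *-distribˡ-+ l₂ b₂ (k * b₃) ⟨
    l₂ * (b₂ + k * b₃)                      ∎
  one≡ : 1 ≡ b₂ + c₂ * b₃
  one≡ = +-cancelˡ-≡ (b₂ * b₃) 1 _ (begin
    b₂ * b₃ + 1                 ≡⟨ *-cancelˡ-≡ _ _ l₂ {{>-nonZero 1≤l₂}} cancelled ⟩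
    b₂ + k * b₃                 ≡⟨ cong (λ t → b₂ + t * b₃) k≡ ⟩
    b₂ + (b₂ + c₂) * b₃         ≡⟨ solve (b₂ ∷ c₂ ∷ b₃ ∷ []) ⟩
    b₂ * b₃ + (b₂ + c₂ * b₃)    ∎)

module CodewordLayers {n : ℕ} (G : Graph n) (bip : Bipartite G) (drg : DistanceRegular G)
  (diam : ∀ x y i → Dist G x y i → i ≤ 4) (p q : Fin n) (far : Dist G p q 4)
  (C : Fin n → Bool) (code : PerfectCode G C) (c : Fin n) (Cc : C c ≡ true) where
  open Graph G renaming (sym to adj-sym)
  open Distances G
  open Neighbourhoods G
  open DistanceRegularGraphs G
  open PerfectCodes G code

  L : ℕ → Fin n → Bool
  L i z = isDist G z c i

  CL NL : ℕ → Fin n → Bool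
  CL i z = L i z ∧ C z
  NL i z = L i z ∧ not (C z)

  k : ℕ
  k = degree c

  layers-disjoint : ∀ i j {z} → L i z ≡ true → i ≢ j → L j z ≡ false
  layers-disjoint i j dᵢ i≢j = ¬-not λ dⱼ → i≢j (dist-unique i j dᵢ dⱼ)

  nbr-layer : ∀ i {x z} → L (suc i) x ≡ true → adj x z ≡ true → L (suc (suc i)) z ≡ true ⊎ L i z ≡ true
  nbr-layer i {z = z} dx xz with j , dz ← proj₁ drg z c with bipartite-adj-dist bip (suc i) j xz dx dz
  ... | inj₁ refl = inj₁ dz
  ... | inj₂ refl = inj₂ dz

  outer-nbr : ∀ {x z} → L 4 x ≡ true → adj x z ≡ true → L 3 z ≡ true
  outer-nbr {z = z} dx xz with nbr-layer 3 dx xz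
  ... | inj₁ d₅ = contradiction (diam z c 5 d₅) λ { (s≤s (s≤s (s≤s (s≤s ())))) }
  ... | inj₂ d₃ = d₃

  no-codeword-in-L1 : ∀ {w} → L 1 w ≡ true → C w ≡ false
  no-codeword-in-L1 d = ¬-not λ Cw → codewords-nonadjacent Cw Cc (dist1⇒adj d)

  no-codeword-in-L2 : ∀ {w} → L 2 w ≡ true → C w ≡ false
  no-codeword-in-L2 d = ¬-not λ Cw → codewords-not-at-distance-2 Cw Cc d

  outward : ∀ i → i < 4 → ∀ {x} → L i x ≡ true → ∃ λ z → adj x z ≡ true × L (suc i) z ≡ true
  outward i i<4 {x} = outward-nbr drg {p} {q} {4} far {x} {c} i i<4

  outward-pos : ∀ i → i < 4 → ∀ {x} → L i x ≡ true → 1 ≤ nbrs x (L (suc i))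
  outward-pos i i<4 {x} dx = let (z , xz , dz) = outward i i<4 dx in nbrs-pos {x} {z} (L (suc i)) xz dz

  outer-nbrs≡k : ∀ {x} → L 4 x ≡ true → nbrs x (L 3) ≡ k
  outer-nbrs≡k {x} dx = trans (nbrs-cong λ z xz → outer-nbr dx xz) (degree-regular drg x c)

  -- The intersection numbers are read off at arbitrary representatives of L₂ and L₃.
  module _ {x₂ x₃ : Fin n} (d₂ : L 2 x₂ ≡ true) (d₃ : L 3 x₃ ≡ true) where
    b₂ c₂ c₃ b₃ a₃ a₄ : ℕ
    b₂ = nbrs x₂ (L 3)
    c₂ = nbrs x₂ (L 1)
    c₃ = nbrs x₃ (L 2)
    b₃ = nbrs x₃ (L 4)
    a₃ = size (CL 3)
    a₄ = size (CL 4)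

    k≡b₂+c₂ : k ≡ b₂ + c₂
    k≡b₂+c₂ = begin
      k                                ≡⟨ degree-regular drg c x₂ ⟩
      degree x₂                        ≡⟨ degree-partition x₂ (L 3) ⟩
      b₂ + nbrs x₂ (not ∘ L 3)          ≡⟨ cong (b₂ +_) (nbrs-cong inner) ⟩
      b₂ + c₂                          ∎
      where
      open ≡-Reasoning
      inner : ∀ z → adj x₂ z ≡ true → not (L 3 z) ≡ L 1 z
      inner z x₂z with nbr-layer 1 d₂ x₂z
      ... | inj₁ d₃′ rewrite d₃′ = sym (layers-disjoint 3 1 {z} d₃′ λ ())
      ... | inj₂ d₁  rewrite d₁  = cong not (layers-disjoint 1 3 {z} d₁ λ ())

    edges-L2-L3 : size (L 2) * b₂ ≡ size (L 3) * c₃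
    edges-L2-L3 = nbrs-double-count (L 2) (L 3) b₂ c₃
      (λ y d → nbrs-outward-const drg 2 d d₂) (λ z d → nbrs-inward-const drg 2 d d₃)

    edges-L3-L4 : size (L 3) * b₃ ≡ size (L 4) * k
    edges-L3-L4 = nbrs-double-count (L 3) (L 4) b₃ k
      (λ y d → nbrs-outward-const drg 3 d d₃) (λ z d → outer-nbrs≡k d)

    size-L2 : size (L 2) ≡ a₃ * c₃
    size-L2 = trans (sym (*-identityʳ _)) (nbrs-double-count (L 2) (CL 3) 1 c₃ covered
      λ w h → nbrs-inward-const drg 2 (∧-conicalˡ _ _ h) d₃)
      where
      covered : ∀ y → L 2 y ≡ true → nbrs y (CL 3) ≡ 1
      covered y d = trans (nbrs-∧-redundant (L 3) C in-L3) (nbrs-code≡1 (no-codeword-in-L2 d))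
        where
        in-L3 : ∀ z → adj y z ≡ true → C z ≡ true → L 3 z ≡ true
        in-L3 z yz Cz with nbr-layer 1 d yz
        ... | inj₁ d₃′ = d₃′
        ... | inj₂ d₁  = contradiction (trans (sym Cz) (no-codeword-in-L1 d₁)) λ ()

    size-L3 : size (L 3) ≡ a₃ + a₄ * k
    size-L3 = begin
      size (L 3)            ≡⟨ size-partition (L 3) C ⟩
      a₃ + size (NL 3)      ≡⟨ cong (a₃ +_) (*-identityʳ _) ⟨
      a₃ + size (NL 3) * 1  ≡⟨ cong (a₃ +_) (nbrs-double-count (NL 3) (CL 4) 1 k covered spread) ⟩
      a₃ + a₄ * k           ∎
      where
      open ≡-Reasoning
      covered : ∀ x → NL 3 x ≡ true → nbrs x (CL 4) ≡ 1
      covered x h = trans (nbrs-∧-redundant (L 4) C in-L4) (nbrs-code≡1 (not-injective (∧-conicalʳ _ _ h)))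
        where
        in-L4 : ∀ z → adj x z ≡ true → C z ≡ true → L 4 z ≡ true
        in-L4 z xz Cz with nbr-layer 2 (∧-conicalˡ _ _ h) xz
        ... | inj₁ d₄  = d₄
        ... | inj₂ d₂′ = contradiction (trans (sym Cz) (no-codeword-in-L2 d₂′)) λ ()
      spread : ∀ w → CL 4 w ≡ true → nbrs w (NL 3) ≡ k
      spread w h = trans (nbrs-noncode (∧-conicalʳ _ _ h) (L 3)) (outer-nbrs≡k (∧-conicalˡ _ _ h))

    size-L4 : size (L 4) ≡ a₄ + a₃ * b₃
    size-L4 = begin
      size (L 4)            ≡⟨ size-partition (L 4) C ⟩
      a₄ + size (NL 4)      ≡⟨ cong (a₄ +_) (*-identityʳ _) ⟨
      a₄ + size (NL 4) * 1  ≡⟨ cong (a₄ +_) (nbrs-double-count (NL 4) (CL 3) 1 b₃ covered spread) ⟩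
      a₄ + a₃ * b₃          ∎
      where
      open ≡-Reasoning
      covered : ∀ x → NL 4 x ≡ true → nbrs x (CL 3) ≡ 1
      covered x h = trans (nbrs-∧-redundant (L 3) C λ z xz _ → outer-nbr (∧-conicalˡ _ _ h) xz)
        (nbrs-code≡1 (not-injective (∧-conicalʳ _ _ h)))
      spread : ∀ w → CL 3 w ≡ true → nbrs w (NL 4) ≡ b₃
      spread w h = trans (nbrs-noncode (∧-conicalʳ _ _ h) (L 4)) (nbrs-outward-const drg 3 (∧-conicalˡ _ _ h) d₃)

    impossible : ⊥
    impossible = layer-equations-inconsistent {a₃ = a₃} {a₄ = a₄}
      k≡b₂+c₂ size-L2 size-L3 size-L4 edges-L2-L3 edges-L3-L4
      (size-pos (L 2) x₂ d₂) (outward-pos 2 (s≤s (s≤s (s≤s z≤n))) d₂) c₂-pos (outward-pos 3 ≤-refl d₃)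
      where
      c₂-pos : 1 ≤ c₂
      c₂-pos = let (u , x₂u , d₁) = dist-pred 1 d₂ in nbrs-pos {x₂} {u} (L 1) x₂u d₁

  absurd : ⊥
  absurd =
    let (x₁ , _ , d₁) = outward 0 (s≤s z≤n) {c} (eqᵇ-refl c)
        (x₂ , _ , d₂) = outward 1 (s≤s (s≤s z≤n)) {x₁} d₁
        (x₃ , _ , d₃) = outward 2 (s≤s (s≤s (s≤s z≤n))) {x₂} d₂
    in impossible {x₂} {x₃} d₂ d₃

proposition5p5 : (n : ℕ) (G : Graph n) → Bipartite G → DistanceRegular G →
    HasDiameter G 4 → ¬ Σ (Fin n → Bool) (PerfectCode G)
proposition5p5 n G bip drg (_ , diam , p , q , far) (C , code)
  with c , Cc , _ ← proj₁ (code p) = CodewordLayers.absurd G bip drg diam p q far C code c Cc
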